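{- Let $r\ge3$ and $\Delta\ge1$ be integers and let $G$ be an $\mathcal{F}^{(2)}(n,\Delta)$-universal graph. Then $\mathcal{H}_r(G)$ is universal for the family of $r$-uniform hypergraphs $F$ on $n$ vertices with $\sigma(F)\le\Delta$.
   Context: $\mathcal{F}^{(2)}(n,\Delta)$ is the family of graphs on $n$ vertices with maximum degree at most $\Delta$; a (hyper)graph is universal for a family if it contains a copy of every member. For a graph $G$, $\mathcal{H}_r(G)$ is the $r$-uniform hypergraph on $V(G)$ with edge set $\{f\in\binom{V(G)}{r}:\exists e\in E(G),\ e\subseteq f\}$. A graph $G'$ hits an $r$-uniform hypergraph $F$ if every edge of $F$ contains an edge of $G'$; $\sigma(F)$ is the smallest maximum degree of a graph hitting $F$. -}

module Defs where

open import Data.Nat using (ℕ; _≤_)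
open import Data.Bool using (Bool; true; false)
open import Data.Fin using (Fin; _≟_)
open import Data.Fin.Subset using (Subset; _∈_; ∣_∣)
open import Data.Fin.Subset.Properties using (_∈?_)
open import Data.Fin.Properties using (any?)
open import Data.Vec using (tabulate)
open import Data.Product using (_×_; ∃-syntax; Σ-syntax; proj₁)
open import Relation.Binary.PropositionalEquality using (_≡_)
open import Relation.Nullary using (does)
open import Relation.Nullary.Decidable using (_×-dec_)
open import Function.Definitions using (Injective)

record Graph (n : ℕ) : Set where
  field
    adj   : Fin n → Fin n → Bool
    sym   : ∀ u v → adj u v ≡ adj v u
    irrefl : ∀ v → adj v v ≡ false
open Graph public

nbhd : ∀ {n} → Graph n → Fin n → Subset n
nbhd G v = tabulate (adj G v)

deg : ∀ {n} → Graph n → Fin n → ℕ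
deg G v = ∣ nbhd G v ∣

MaxDegAtMost : ∀ {n} → ℕ → Graph n → Set
MaxDegAtMost Δ G = ∀ v → deg G v ≤ Δ

_⊑_ : ∀ {n N} → Graph n → Graph N → Set
_⊑_ {n} {N} H G = Σ[ φ ∈ (Fin n → Fin N) ] (Injective _≡_ _≡_ φ ×
  (∀ u v → adj H u v ≡ true → adj G (φ u) (φ v) ≡ true))

UniversalGraph : ∀ {N} → ℕ → ℕ → Graph N → Set
UniversalGraph n Δ G = (H : Graph n) → MaxDegAtMost Δ H → H ⊑ G

record Hypergraph (r n : ℕ) : Set₁ where
  field
    Edge    : Subset n → Set
    uniform : ∀ f → Edge f → ∣ f ∣ ≡ r
open Hypergraph public

image : ∀ {n N} → (Fin n → Fin N) → Subset n → Subset N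
image φ f = tabulate (λ x → does (any? (λ y → (y ∈? f) ×-dec (φ y ≟ x))))

_⊑ʰ_ : ∀ {r n N} → Hypergraph r n → Hypergraph r N → Set
_⊑ʰ_ {r} {n} {N} F K = Σ[ φ ∈ (Fin n → Fin N) ] (Injective _≡_ _≡_ φ ×
  (∀ f → Edge F f → Edge K (image φ f)))

Hr : ∀ {N} (r : ℕ) → Graph N → Hypergraph r N
Hr r G = record
  { Edge    = λ f → ∣ f ∣ ≡ r × (∃[ u ] ∃[ v ] (u ∈ f × v ∈ f × adj G u v ≡ true))
  ; uniform = λ f e → proj₁ e
  }

Hits : ∀ {r n} → Graph n → Hypergraph r n → Set
Hits G' F = ∀ f → Edge F f → ∃[ u ] ∃[ v ] (u ∈ f × v ∈ f × adj G' u v ≡ true)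

-- σ(F) ≤ Δ : some graph of maximum degree ≤ Δ hits F
-- (σ(F) is the minimum such Δ, so this is the unfolding of σ(F) ≤ Δ)
σ≤ : ∀ {r n} → Hypergraph r n → ℕ → Set
σ≤ F Δ = ∃[ G' ] (MaxDegAtMost Δ G' × Hits G' F)

module Submission where

-- Let G' be a graph of maximum degree at most Δ hitting F
-- (this is what σ(F) ≤ Δ means).  By universality of G there is an
-- injective homomorphism φ : G' → G.  The same map embeds F into H_r(G):
-- an edge f of F contains an edge uv of G', so its image φ[f] contains the
-- edge φ(u)φ(v) of G, and φ[f] still has r elements because φ is injective.

open import Defs hiding (sym)
open import Data.Nat using (ℕ; _≤_; suc; zero)
open import Data.Fin using (Fin; _≟_) renaming (zero to fzero; suc to fsuc)
open import Data.Fin.Subset using (Subset; _∈_; _∉_; ∣_∣; ⁅_⁆; ⊥; _∪_; inside; outside)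
open import Data.Fin.Subset.Properties using (_∈?_; ⊆-antisym; x∈p∪q⁻; x∈p∪q⁺; x∈⁅x⁆; x∈⁅y⁆⇒x≡y; ∪-identityˡ; ∣⊥∣≡0; ∉⊥)
open import Data.Fin.Properties using (any?; suc-injective)
open import Data.Vec using (_∷_; []; here; there; lookup)
open import Data.Vec.Properties using (lookup∘tabulate; []=⇒lookup; lookup⇒[]=)
open import Data.Product using (_×_; _,_; ∃-syntax)
open import Data.Sum using (inj₁; inj₂)
open import Function.Definitions using (Injective)
open import Relation.Binary.PropositionalEquality using (_≡_; refl; sym; trans; cong; module ≡-Reasoning)
open import Relation.Nullary using (Dec; does; yes; no; contradiction)
open import Relation.Nullary.Decidable using (_×-dec_)

Preimage : ∀ {n N} → (Fin n → Fin N) → Subset n → Fin N → Set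
Preimage φ f x = ∃[ y ] (y ∈ f × φ y ≡ x)

module _ {n N : ℕ} (φ : Fin n → Fin N) (f : Subset n) where

  preimage? : ∀ x → Dec (Preimage φ f x)
  preimage? x = any? (λ y → (y ∈? f) ×-dec (φ y ≟ x))

  image-elim : ∀ {x} → x ∈ image φ f → Preimage φ f x
  image-elim {x} x∈ with preimage? x | lookup∘tabulate (λ z → does (preimage? z)) x
  ... | yes pre | _  = pre
  ... | no _    | eq = contradiction (trans (sym eq) ([]=⇒lookup x∈)) λ ()

  image-intro : ∀ {x} → Preimage φ f x → x ∈ image φ f
  image-intro {x} pre with preimage? x | lookup∘tabulate (λ z → does (preimage? z)) x
  ... | yes _   | eq = lookup⇒[]= x _ eq
  ... | no ¬pre | _  = contradiction pre ¬pre

image-[] : ∀ {N} (φ : Fin 0 → Fin N) → image φ [] ≡ ⊥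
image-[] φ = ⊆-antisym (λ x∈ → absurd (image-elim φ [] x∈)) (λ x∈⊥ → contradiction x∈⊥ ∉⊥)
  where
  absurd : ∀ {x} → Preimage φ [] x → x ∈ ⊥
  absurd (() , _)

φ⁺ : ∀ {n N} → (Fin (suc n) → Fin N) → Fin n → Fin N
φ⁺ φ y = φ (fsuc y)

φ⁺-injective : ∀ {n N} {φ : Fin (suc n) → Fin N} → Injective _≡_ _≡_ φ → Injective _≡_ _≡_ (φ⁺ φ)
φ⁺-injective inj eq = suc-injective (inj eq)

module _ {n N : ℕ} (φ : Fin (suc n) → Fin N) (f : Subset n) where

  image-outside : image φ (outside ∷ f) ≡ image (φ⁺ φ) f
  image-outside = ⊆-antisym to from
    where
    to : ∀ {x} → x ∈ image φ (outside ∷ f) → x ∈ image (φ⁺ φ) f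
    to x∈ with image-elim φ (outside ∷ f) x∈
    ... | fsuc y , there y∈f , eq = image-intro (φ⁺ φ) f (y , y∈f , eq)
    from : ∀ {x} → x ∈ image (φ⁺ φ) f → x ∈ image φ (outside ∷ f)
    from x∈ with image-elim (φ⁺ φ) f x∈
    ... | y , y∈f , eq = image-intro φ (outside ∷ f) (fsuc y , there y∈f , eq)

  image-inside : image φ (inside ∷ f) ≡ ⁅ φ fzero ⁆ ∪ image (φ⁺ φ) f
  image-inside = ⊆-antisym to from
    where
    to : ∀ {x} → x ∈ image φ (inside ∷ f) → x ∈ ⁅ φ fzero ⁆ ∪ image (φ⁺ φ) f
    to x∈ with image-elim φ (inside ∷ f) x∈
    ... | fzero  , _         , refl = x∈p∪q⁺ (inj₁ (x∈⁅x⁆ _))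
    ... | fsuc y , there y∈f , eq   = x∈p∪q⁺ (inj₂ (image-intro (φ⁺ φ) f (y , y∈f , eq)))
    from : ∀ {x} → x ∈ ⁅ φ fzero ⁆ ∪ image (φ⁺ φ) f → x ∈ image φ (inside ∷ f)
    from x∈ with x∈p∪q⁻ _ _ x∈
    ... | inj₁ x∈⁅φ0⁆ = image-intro φ (inside ∷ f) (fzero , here , sym (x∈⁅y⁆⇒x≡y _ x∈⁅φ0⁆))
    ... | inj₂ x∈img with image-elim (φ⁺ φ) f x∈img
    ...   | y , y∈f , eq = image-intro φ (inside ∷ f) (fsuc y , there y∈f , eq)

∣⁅x⁆∪p∣≡1+∣p∣ : ∀ {N} (x : Fin N) (p : Subset N) → x ∉ p → ∣ ⁅ x ⁆ ∪ p ∣ ≡ suc ∣ p ∣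
∣⁅x⁆∪p∣≡1+∣p∣ fzero    (outside ∷ p) _   = cong suc (cong ∣_∣ (∪-identityˡ p))
∣⁅x⁆∪p∣≡1+∣p∣ fzero    (inside ∷ p)  x∉p = contradiction here x∉p
∣⁅x⁆∪p∣≡1+∣p∣ (fsuc x) (outside ∷ p) x∉p = ∣⁅x⁆∪p∣≡1+∣p∣ x p (λ x∈p → x∉p (there x∈p))
∣⁅x⁆∪p∣≡1+∣p∣ (fsuc x) (inside ∷ p)  x∉p = cong suc (∣⁅x⁆∪p∣≡1+∣p∣ x p (λ x∈p → x∉p (there x∈p)))

∣image∣≡∣_∣ : ∀ {n N} {φ : Fin n → Fin N} → Injective _≡_ _≡_ φ → (f : Subset n) →
  ∣ image φ f ∣ ≡ ∣ f ∣
∣image∣≡∣_∣ {zero} {N} {φ} _ [] = trans (cong ∣_∣ (image-[] φ)) (∣⊥∣≡0 N)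
∣image∣≡∣_∣ {suc n} {N} {φ} inj (outside ∷ f) =
  trans (cong ∣_∣ (image-outside φ f)) (∣image∣≡∣ φ⁺-injective inj ∣ f)
∣image∣≡∣_∣ {suc n} {N} {φ} inj (inside ∷ f) =
  begin
    ∣ image φ (inside ∷ f) ∣                 ≡⟨ cong ∣_∣ (image-inside φ f) ⟩
    ∣ ⁅ φ fzero ⁆ ∪ image (φ⁺ φ) f ∣         ≡⟨ ∣⁅x⁆∪p∣≡1+∣p∣ (φ fzero) (image (φ⁺ φ) f) φ0∉ ⟩
    suc ∣ image (φ⁺ φ) f ∣                   ≡⟨ cong suc (∣image∣≡∣ φ⁺-injective inj ∣ f) ⟩
    suc ∣ f ∣                                ∎
  where
  open ≡-Reasoning
  φ0∉ : φ fzero ∉ image (φ⁺ φ) f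
  φ0∉ φ0∈ with image-elim (φ⁺ φ) f φ0∈
  ... | y , _ , eq with inj eq
  ...   | ()

hitting-copy⇒Hr-copy : ∀ {r n N} (G : Graph N) (G' : Graph n) (F : Hypergraph r n) →
  Hits G' F → G' ⊑ G → F ⊑ʰ Hr r G
hitting-copy⇒Hr-copy {r} G G' F hits (φ , inj , hom) = φ , inj , edge↦edge
  where
  edge↦edge : ∀ f → Edge F f → Edge (Hr r G) (image φ f)
  edge↦edge f e with hits f e
  ... | u , v , u∈f , v∈f , uv∈G' =
    trans (∣image∣≡∣ inj ∣ f) (uniform F f e) ,
    φ u , φ v ,
    image-intro φ f (u , u∈f , refl) , image-intro φ f (v , v∈f , refl) ,
    hom u v uv∈G'

lemma5p2 : (r Δ n N : ℕ) → 3 ≤ r → 1 ≤ Δ → (G : Graph N) → UniversalGraph n Δ G →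
    (F : Hypergraph r n) → σ≤ F Δ → F ⊑ʰ Hr r G
lemma5p2 r Δ n N _ _ G universal F (G' , maxDeg , hits) =
  hitting-copy⇒Hr-copy G G' F hits (universal G' maxDeg)
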